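{- For every integer $n\ge4$ with $n\ne5$, the path $\mathcal{P}_n$ on $n$ vertices is not uniquely cointersectable.
   Context: Graphs are finite, simple and undirected. For a graph $\mathcal{G}=(\mathcal{V},\mathcal{E})$ and positive integers $\alpha,\beta$, an $(\alpha\mid\beta)$-cointersection representation (CIR) of $\mathcal{G}$ consists of two disjoint finite sets of features $\mathcal{A},\mathcal{B}$ with $|\mathcal{A}|=\alpha$, $|\mathcal{B}|=\beta$, together with an assignment to each vertex $v$ of subsets $A_v\subseteq\mathcal{A}$, $B_v\subseteq\mathcal{B}$ (possibly empty), such that for all distinct $u,v\in\mathcal{V}$: $(u,v)\in\mathcal{E}$ if and only if $A_u\cap A_v\neq\varnothing$ and $B_u\cap B_v\neq\varnothing$. The cointersection number $\theta^{c}(\mathcal{G})$ is the minimum of $\alpha+\beta$ over all CIRs of $\mathcal{G}$; a CIR is optimal if $\alpha+\beta=\theta^{c}(\mathcal{G})$. Two CIRs $(\mathcal{A},\mathcal{B},(A_v,B_v)_v)$ and $(\mathcal{A}',\mathcal{B}',(A'_v,B'_v)_v)$ of the same graph are equivalent if either there are bijections $\varphi:\mathcal{A}\to\mathcal{A}'$, $\psi:\mathcal{B}\to\mathcal{B}'$ with $A'_v=\varphi(A_v)$, $B'_v=\psi(B_v)$ for all $v$, or there are bijections $\varphi:\mathcal{A}\to\mathcal{B}'$, $\psi:\mathcal{B}\to\mathcal{A}'$ with $B'_v=\varphi(A_v)$, $A'_v=\psi(B_v)$ for all $v$. A graph is uniquely cointersectable if all of its optimal CIRs are pairwise equivalent.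 -}

module Defs where

open import Data.Nat using (ℕ; suc; _+_; _≤_)
open import Data.Fin using (Fin; toℕ)
open import Data.Fin.Subset using (Subset; _∈_; _∩_; Nonempty)
open import Data.Product using (Σ; ∃; _×_; _,_)
open import Data.Sum using (_⊎_)
open import Relation.Binary.PropositionalEquality using (_≡_)
open import Relation.Nullary using (¬_)
open import Function.Bundles using (_⇔_; _⤖_; Bijection)

Graph : ℕ → Set₁
Graph n = Fin n → Fin n → Set

Path : (n : ℕ) → Graph n
Path n u v = (suc (toℕ u) ≡ toℕ v) ⊎ (suc (toℕ v) ≡ toℕ u)

-- An (α|β)-cointersection representation of G.  The feature sets are
-- Fin α and Fin β (disjoint as distinct types); A v ⊆ Fin α, B v ⊆ Fin β.
record CIR {n : ℕ} (G : Graph n) : Set where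
  field
    α β   : ℕ
    α-pos : 1 ≤ α
    β-pos : 1 ≤ β
    A     : Fin n → Subset α
    B     : Fin n → Subset β
    rep   : ∀ u v → ¬ (u ≡ v) →
            G u v ⇔ (Nonempty (A u ∩ A v) × Nonempty (B u ∩ B v))

open CIR public

size : ∀ {n} {G : Graph n} → CIR G → ℕ
size R = α R + β R

Optimal : ∀ {n} {G : Graph n} → CIR G → Set
Optimal {G = G} R = (R' : CIR G) → size R ≤ size R'

_IsImageOf_Under_ : ∀ {a b} → Subset b → Subset a → (Fin a → Fin b) → Set
Y IsImageOf X Under f = ∀ y → (y ∈ Y) ⇔ (∃ λ x → x ∈ X × f x ≡ y)

Equivalent : ∀ {n} {G : Graph n} → CIR G → CIR G → Set
Equivalent R R' =
  (Σ (Fin (α R) ⤖ Fin (α R')) λ φ → Σ (Fin (β R) ⤖ Fin (β R')) λ ψ →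
     ∀ v → (A R' v IsImageOf A R v Under Bijection.to φ)
         × (B R' v IsImageOf B R v Under Bijection.to ψ))
  ⊎
  (Σ (Fin (α R) ⤖ Fin (β R')) λ φ → Σ (Fin (β R) ⤖ Fin (α R')) λ ψ →
     ∀ v → (B R' v IsImageOf A R v Under Bijection.to φ)
         × (A R' v IsImageOf B R v Under Bijection.to ψ))

UniquelyCointersectable : ∀ {n} → Graph n → Set
UniquelyCointersectable G =
  (R R' : CIR G) → Optimal R → Optimal R' → Equivalent R R'

module Submission where

-- Vertices 1 and 2 are twins in a CIR if they carry the same A-set or the same
-- B-set; equivalences of CIRs preserve twinship.  Every CIR of P_{m+1} has
-- m ≤ αβ, since distinct edges need distinct pairs of shared features.
-- Conversely, a rook path (m distinct cells of a p × q grid, consecutive cells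
-- sharing a row or a column) gives a (p|q)-CIR of P_{m+1}: each vertex gets the
-- rows and columns of the cells of its edges, and the first three cells decide
-- whether 1 and 2 are twins.  Rook paths are built from snakes by truncation,
-- transposition, mirroring and stacking.  Given an optimal CIR, we keep α + β
-- and reshape the grid twice: to one with a side ≥ 3 (using m ≥ 3, m ≠ 4),
-- where a row-by-row snake makes 1, 2 twins, and to one with both sides ≥ 2,
-- where a path turning at once makes them non-twins.  Both CIRs are optimal,
-- so they are not equivalent.

open import Defs
open import Data.Nat using (ℕ; zero; suc; pred; _+_; _*_; _∸_; _⊓_; _≤_; _<_; _≟_; _<?_; _≤?_; z≤n; s≤s; s≤s⁻¹)
open import Data.Nat.Properties
  using (≤-refl; ≤-trans; ≤-reflexive; <-≤-trans; ≤-<-trans; ≤-antisym; <⇒≢; <⇒≱; ≰⇒>; ≮⇒≥;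
         n≤1+n; m≤m+n; m≤n+m; +-comm; +-suc; +-monoʳ-<; +-identityʳ; +-cancelˡ-≡; *-comm; *-identityˡ; *-distribʳ-+;
         *-cancelʳ-<; m∸n≤m; ∸-monoˡ-<; m+n∸m≡n; ∸-cancelˡ-≡; ∸-cancelʳ-≡; +-∸-assoc; n∸n≡0;
         m≤n⇒m⊓n≡m; m≥n⇒m⊓n≡n; m⊓n≤n; <⇒≤pred; suc-injective; 1+n≢n)
open import Data.Bool.Properties using (T-≡)
open import Data.Fin using (Fin; zero; suc; toℕ; fromℕ<; inject₁; combine)
open import Data.Fin.Properties
  using (toℕ<n; toℕ-fromℕ<; toℕ-injective; toℕ-inject₁; combine-injective; injective⇒≤; <-cmp)
open import Data.Fin.Subset using (Subset; _∈_; _∩_; Nonempty)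
open import Data.Fin.Subset.Properties using (x∈p∩q⁺; x∈p∩q⁻; ⊆-antisym)
open import Data.Vec using (tabulate)
open import Data.Vec.Properties using (lookup∘tabulate; []=⇒lookup; lookup⇒[]=)
open import Data.Product using (Σ; _×_; _,_; proj₁; proj₂; swap)
open import Data.Sum using (_⊎_; inj₁; inj₂; [_,_]; map₁; map₂)
open import Function using (_∘_)
open import Data.Empty using (⊥; ⊥-elim)
open import Relation.Binary using (tri<; tri≈; tri>)
open import Relation.Binary.PropositionalEquality hiding ([_])
open import Relation.Nullary using (¬_; Dec; yes; no)
open import Relation.Nullary.Decidable using (isYes; _⊎-dec_; toWitness; fromWitness)
open import Function.Bundles using (_⇔_; mk⇔; Equivalence)

-- Sizes are natural numbers, so a graph with a CIR has an optimal one; as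
-- minimisation over all CIRs is not decidable, this holds in double-negated
-- form, which suffices to refute a statement.
optimal-exists : ∀ {n} {G : Graph n} → CIR G → ¬ ¬ Σ (CIR G) Optimal
optimal-exists {G = G} R₀ none = nothing-below (size R₀) R₀ ≤-refl
  where
  nothing-below : ∀ k (R : CIR G) → size R ≤ k → ⊥
  nothing-below zero R ≤0 = none (R , λ R' → ≤-trans ≤0 z≤n)
  nothing-below (suc k) R ≤k+1 = none (R , minimal)
    where
    minimal : Optimal R
    minimal R' with size R ≤? size R'
    ... | yes ≤R' = ≤R'
    ... | no ≰R' = ⊥-elim (nothing-below k R' (s≤s⁻¹ (≤-trans (≰⇒> ≰R') ≤k+1)))

optimal-of-size : ∀ {n} {G : Graph n} (R S : CIR G) → Optimal R → size S ≡ size R → Optimal S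
optimal-of-size R S opt eq R' = subst (_≤ size R') (sym eq) (opt R')

same-image : ∀ {a b} {X X' : Subset a} {Y Y' : Subset b} {f : Fin a → Fin b} →
             Y IsImageOf X Under f → Y' IsImageOf X' Under f → X ≡ X' → Y ≡ Y'
same-image img img' refl = ⊆-antisym
  (λ {y} y∈Y → Equivalence.from (img' y) (Equivalence.to (img y) y∈Y))
  (λ {y} y∈Y' → Equivalence.from (img y) (Equivalence.to (img' y) y∈Y'))

Twins : ∀ {n} {G : Graph n} → CIR G → Fin n → Fin n → Set
Twins R u v = A R u ≡ A R v ⊎ B R u ≡ B R v

twins-invariant : ∀ {n} {G : Graph n} {R R' : CIR G} (u v : Fin n) →
                  Equivalent R R' → Twins R u v → Twins R' u v
twins-invariant u v (inj₁ (_ , _ , img)) (inj₁ eq) = inj₁ (same-image (proj₁ (img u)) (proj₁ (img v)) eq)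
twins-invariant u v (inj₁ (_ , _ , img)) (inj₂ eq) = inj₂ (same-image (proj₂ (img u)) (proj₂ (img v)) eq)
twins-invariant u v (inj₂ (_ , _ , img)) (inj₁ eq) = inj₂ (same-image (proj₁ (img u)) (proj₁ (img v)) eq)
twins-invariant u v (inj₂ (_ , _ , img)) (inj₂ eq) = inj₁ (same-image (proj₂ (img u)) (proj₂ (img v)) eq)

bridge : ∀ {s} {X Y Z W : Subset s} {x y : Fin s} → x ∈ X ∩ Y → y ∈ Z ∩ W → x ≡ y → Nonempty (X ∩ W)
bridge {X = X} {Y} {Z} {W} x∈ y∈ refl = _ , x∈p∩q⁺ (proj₁ (x∈p∩q⁻ X Y x∈) , proj₂ (x∈p∩q⁻ Z W y∈))

module _ {m : ℕ} (R : CIR (Path (suc m))) where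

  edge-features : (k : Fin m) → Nonempty (A R (inject₁ k) ∩ A R (suc k)) × Nonempty (B R (inject₁ k) ∩ B R (suc k))
  edge-features k = Equivalence.to (rep R (inject₁ k) (suc k) ends-differ) (inj₁ (cong suc (toℕ-inject₁ k)))
    where
    ends-differ : ¬ inject₁ k ≡ suc k
    ends-differ eq = 1+n≢n (sym (trans (sym (toℕ-inject₁ k)) (cong toℕ eq)))

  edge-cell : Fin m → Fin (α R * β R)
  edge-cell k = combine (proj₁ (proj₁ (edge-features k))) (proj₁ (proj₂ (edge-features k)))

  -- If edges k < l had the same cell, vertices k and l+1 would share features
  -- although they are not adjacent.
  edge-cells-differ : ∀ {k l : Fin m} → toℕ k < toℕ l → ¬ edge-cell k ≡ edge-cell l
  edge-cells-differ {k} {l} k<l same =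
    not-adjacent (Equivalence.from (rep R (inject₁ k) (suc l) distinct) (shared-A , shared-B))
    where
    features-equal : proj₁ (proj₁ (edge-features k)) ≡ proj₁ (proj₁ (edge-features l))
                   × proj₁ (proj₂ (edge-features k)) ≡ proj₁ (proj₂ (edge-features l))
    features-equal = combine-injective _ _ _ _ same
    shared-A : Nonempty (A R (inject₁ k) ∩ A R (suc l))
    shared-A = bridge (proj₂ (proj₁ (edge-features k))) (proj₂ (proj₁ (edge-features l))) (proj₁ features-equal)
    shared-B : Nonempty (B R (inject₁ k) ∩ B R (suc l))
    shared-B = bridge (proj₂ (proj₂ (edge-features k))) (proj₂ (proj₂ (edge-features l))) (proj₂ features-equal)
    distinct : ¬ inject₁ k ≡ suc l
    distinct eq = <⇒≱ k<l (≤-trans (n≤1+n _) (≤-reflexive (trans (sym (cong toℕ eq)) (toℕ-inject₁ k))))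
    not-adjacent : ¬ Path (suc m) (inject₁ k) (suc l)
    not-adjacent (inj₁ e) = <⇒≢ k<l (suc-injective (trans (cong suc (sym (toℕ-inject₁ k))) e))
    not-adjacent (inj₂ e) = <⇒≱ k<l (≤-trans (m≤n+m (toℕ l) 2) (≤-reflexive (trans e (toℕ-inject₁ k))))

  edges≤cells : m ≤ α R * β R
  edges≤cells = injective⇒≤ {f = edge-cell} injective
    where
    injective : ∀ {k l} → edge-cell k ≡ edge-cell l → k ≡ l
    injective {k} {l} eq with <-cmp k l
    ... | tri< k<l _ _ = ⊥-elim (edge-cells-differ k<l eq)
    ... | tri≈ _ k≡l _ = k≡l
    ... | tri> _ _ l<k = ⊥-elim (edge-cells-differ l<k (sym eq))

-- Rook paths: m distinct cells of the p × q grid (row, column), consecutive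
-- cells in line.  Only the cells with index < m matter.
row col : ℕ × ℕ → ℕ
row = proj₁
col = proj₂

InLine : ℕ × ℕ → ℕ × ℕ → Set
InLine c c' = row c ≡ row c' ⊎ col c ≡ col c'

record RookPath (p q m : ℕ) : Set where
  field
    cell     : ℕ → ℕ × ℕ
    bounded  : ∀ {k} → k < m → row (cell k) < p × col (cell k) < q
    distinct : ∀ {k l} → k < m → l < m → cell k ≡ cell l → k ≡ l
    inLine   : ∀ {k} → suc k < m → InLine (cell k) (cell (suc k))

truncate : ∀ {p q m M} → m ≤ M → RookPath p q M → RookPath p q m
truncate m≤M P = record
  { cell     = cell
  ; bounded  = λ k<m → bounded (<-≤-trans k<m m≤M)
  ; distinct = λ k<m l<m → distinct (<-≤-trans k<m m≤M) (<-≤-trans l<m m≤M)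
  ; inLine   = λ k+1<m → inLine (<-≤-trans k+1<m m≤M)
  }
  where open RookPath P

transpose : ∀ {p q m} → RookPath p q m → RookPath q p m
transpose P = record
  { cell     = λ k → swap (cell k)
  ; bounded  = λ k<m → swap (bounded k<m)
  ; distinct = λ k<m l<m eq → distinct k<m l<m (cong swap eq)
  ; inLine   = λ k+1<m → [ inj₂ , inj₁ ] (inLine k+1<m)
  }
  where open RookPath P

mirror : ∀ {p q m} → RookPath p q m → RookPath p q m
mirror {q = q} P = record
  { cell     = reflect ∘ cell
  ; bounded  = λ k<m → proj₁ (bounded k<m) , reflected< (proj₂ (bounded k<m))
  ; distinct = λ k<m l<m eq → distinct k<m l<m (cong₂ _,_ (cong row eq)
                 (∸-cancelˡ-≡ (<⇒≤pred (proj₂ (bounded k<m))) (<⇒≤pred (proj₂ (bounded l<m))) (cong col eq)))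
  ; inLine   = λ k+1<m → map₂ (cong (pred q ∸_)) (inLine k+1<m)
  }
  where
  open RookPath P
  reflect : ℕ × ℕ → ℕ × ℕ
  reflect (r , c) = r , pred q ∸ c
  reflected< : ∀ {c} → c < q → pred q ∸ c < q
  reflected< {c} (s≤s _) = s≤s (m∸n≤m (pred q) c)

module Stack {p₁ p₂ q T m : ℕ} (P : RookPath p₁ q T) (Q : RookPath p₂ q m)
             (junction : col (RookPath.cell P (pred T)) ≡ col (RookPath.cell Q 0)) where
  private
    module P = RookPath P
    module Q = RookPath Q

  lowered : ℕ → ℕ × ℕ
  lowered k = p₁ + row (Q.cell k) , col (Q.cell k)

  pick : (k : ℕ) → Dec (k < T) → ℕ × ℕ
  pick k (yes _) = P.cell k
  pick k (no _) = lowered (k ∸ T)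

  cell : ℕ → ℕ × ℕ
  cell k = pick k (k <? T)

  data CellView (k : ℕ) : Set where
    upper : k < T → cell k ≡ P.cell k → CellView k
    lower : T ≤ k → cell k ≡ lowered (k ∸ T) → CellView k

  view : ∀ k → CellView k
  view k with k <? T in decided
  ... | yes k<T = upper k<T (cong (pick k) decided)
  ... | no k≮T = lower (≮⇒≥ k≮T) (cong (pick k) decided)

  lowered-index< : ∀ {k} → k < T + m → T ≤ k → k ∸ T < m
  lowered-index< {k} k<T+m T≤k = subst (k ∸ T <_) (m+n∸m≡n T m) (∸-monoˡ-< k<T+m T≤k)

  bounded : ∀ {k} → k < T + m → row (cell k) < p₁ + p₂ × col (cell k) < q
  bounded {k} k< with view k
  ... | upper k<T eq rewrite eq = ≤-trans (proj₁ (P.bounded k<T)) (m≤m+n p₁ p₂) , proj₂ (P.bounded k<T)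
  ... | lower T≤k eq rewrite eq = let (r< , c<) = Q.bounded (lowered-index< k< T≤k) in +-monoʳ-< p₁ r< , c<

  upper≢lower : ∀ {k l} → k < T → ¬ P.cell k ≡ lowered l
  upper≢lower k<T eq = <⇒≱ (proj₁ (P.bounded k<T)) (≤-trans (m≤m+n p₁ _) (≤-reflexive (sym (cong row eq))))

  distinct : ∀ {k l} → k < T + m → l < T + m → cell k ≡ cell l → k ≡ l
  distinct {k} {l} k< l< eq with view k | view l
  ... | upper k<T ek | upper l<T el = P.distinct k<T l<T (trans (sym ek) (trans eq el))
  ... | upper k<T ek | lower _ el = ⊥-elim (upper≢lower k<T (trans (sym ek) (trans eq el)))
  ... | lower _ ek | upper l<T el = ⊥-elim (upper≢lower l<T (sym (trans (sym ek) (trans eq el))))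
  ... | lower T≤k ek | lower T≤l el = ∸-cancelʳ-≡ T≤k T≤l
        (Q.distinct (lowered-index< k< T≤k) (lowered-index< l< T≤l)
          (cong₂ _,_ (+-cancelˡ-≡ p₁ _ _ (cong row same)) (cong col same)))
    where
    same : lowered (k ∸ T) ≡ lowered (l ∸ T)
    same = trans (sym ek) (trans eq el)

  inLine : ∀ {k} → suc k < T + m → InLine (cell k) (cell (suc k))
  inLine {k} k+1< with view k | view (suc k)
  ... | upper _ ek | upper k+1<T ek' rewrite ek | ek' = P.inLine k+1<T
  ... | upper k<T ek | lower T≤k+1 ek' rewrite ek | ek' = inj₂ (begin
        col (P.cell k)                 ≡⟨ cong (col ∘ P.cell ∘ pred) k+1≡T ⟩
        col (P.cell (pred T))          ≡⟨ junction ⟩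
        col (Q.cell 0)                 ≡⟨ cong (col ∘ Q.cell) (sym (trans (cong (_∸ T) k+1≡T) (n∸n≡0 T))) ⟩
        col (Q.cell (suc k ∸ T))       ∎)
    where
    open ≡-Reasoning
    k+1≡T : suc k ≡ T
    k+1≡T = ≤-antisym k<T T≤k+1
  ... | lower T≤k _ | upper k+1<T _ = ⊥-elim (<⇒≱ k+1<T (≤-trans T≤k (n≤1+n k)))
  ... | lower T≤k ek | lower _ ek' rewrite ek | ek' | +-∸-assoc 1 T≤k =
        map₁ (cong (p₁ +_)) (Q.inLine (subst (_< m) (+-∸-assoc 1 T≤k) (lowered-index< k+1< (≤-trans T≤k (n≤1+n k)))))

stack : ∀ {p₁ p₂ q T m} (P : RookPath p₁ q T) (Q : RookPath p₂ q m) →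
        col (RookPath.cell P (pred T)) ≡ col (RookPath.cell Q 0) → RookPath (p₁ + p₂) q (T + m)
stack P Q junction = record { cell = cell ; bounded = bounded ; distinct = distinct ; inLine = inLine }
  where open Stack P Q junction

-- The snake (boustrophedon) through a grid of width w: cells are visited row by
-- row, even rows left to right and odd rows right to left.
module Snake (w : ℕ) where

  -- position k = (row, offset) of the k-th cell in reading order.
  advance : (r t : ℕ) → Dec (suc t < w) → ℕ × ℕ
  advance r t (yes _) = r , suc t
  advance r t (no _) = suc r , 0

  next : ℕ × ℕ → ℕ × ℕ
  next (r , t) = advance r t (suc t <? w)

  position : ℕ → ℕ × ℕ
  position zero = 0 , 0
  position (suc k) = next (position k)

  orient : ℕ → ℕ → ℕ
  orient zero t = t
  orient (suc zero) t = pred w ∸ t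
  orient (suc (suc r)) t = orient r t

  cell : ℕ → ℕ × ℕ
  cell k = row (position k) , orient (row (position k)) (col (position k))

  data Step (r t : ℕ) : Set where
    along : suc t < w → next (r , t) ≡ (r , suc t) → Step r t
    wrap  : suc t ≡ w → next (r , t) ≡ (suc r , 0) → Step r t

  step : ∀ r t → t < w → Step r t
  step r t t<w with suc t <? w in decided
  ... | yes t+1<w = along t+1<w (cong (advance r t) decided)
  ... | no t+1≮w = wrap (≤-antisym t<w (≮⇒≥ t+1≮w)) (cong (advance r t) decided)

  turn : ∀ r → orient r (pred w) ≡ orient (suc r) 0
  turn zero = refl
  turn (suc zero) = n∸n≡0 (pred w)
  turn (suc (suc r)) = turn r

  orient< : ∀ r {t} → t < w → orient r t < w
  orient< zero t<w = t<w
  orient< (suc zero) {t} (s≤s _) = s≤s (m∸n≤m (pred w) t)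
  orient< (suc (suc r)) t<w = orient< r t<w

  orient-injective : ∀ r {t t'} → t < w → t' < w → orient r t ≡ orient r t' → t ≡ t'
  orient-injective zero _ _ eq = eq
  orient-injective (suc zero) t<w t'<w eq = ∸-cancelˡ-≡ (<⇒≤pred t<w) (<⇒≤pred t'<w) eq
  orient-injective (suc (suc r)) t<w t'<w eq = orient-injective r t<w t'<w eq

  module _ (w>0 : 0 < w) where

    offset< : ∀ k → col (position k) < w
    offset< zero = w>0
    offset< (suc k) with step (row (position k)) (col (position k)) (offset< k)
    ... | along t+1<w eq rewrite eq = t+1<w
    ... | wrap _ eq rewrite eq = w>0

    index : ∀ k → row (position k) * w + col (position k) ≡ k
    index zero = refl
    index (suc k) with step (row (position k)) (col (position k)) (offset< k)
    ... | along _ eq rewrite eq = trans (+-suc _ _) (cong suc (index k))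
    ... | wrap t+1≡w eq rewrite eq = begin
          w + r * w + 0     ≡⟨ +-identityʳ _ ⟩
          w + r * w         ≡⟨ cong (_+ r * w) (sym t+1≡w) ⟩
          suc t + r * w     ≡⟨ cong suc (+-comm t (r * w)) ⟩
          suc (r * w + t)   ≡⟨ cong suc (index k) ⟩
          suc k             ∎
      where
      open ≡-Reasoning
      r = row (position k)
      t = col (position k)

    cell-injective : ∀ k l → cell k ≡ cell l → k ≡ l
    cell-injective k l eq = begin
          k                                           ≡⟨ sym (index k) ⟩
          row (position k) * w + col (position k)     ≡⟨ cong₂ (λ r t → r * w + t) same-row same-offset ⟩
          row (position l) * w + col (position l)     ≡⟨ index l ⟩
          l                                           ∎
      where
      open ≡-Reasoning
      same-row : row (position k) ≡ row (position l)
      same-row = cong row eq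
      same-offset : col (position k) ≡ col (position l)
      same-offset = orient-injective (row (position k)) (offset< k) (offset< l)
                      (trans (cong col eq) (cong (λ r → orient r (col (position l))) (sym same-row)))

    cell-inLine : ∀ k → InLine (cell k) (cell (suc k))
    cell-inLine k with step (row (position k)) (col (position k)) (offset< k)
    ... | along _ eq rewrite eq = inj₁ refl
    ... | wrap t+1≡w eq rewrite eq = inj₂ (trans (cong (orient (row (position k))) (cong pred t+1≡w)) (turn (row (position k))))

    snake : (h : ℕ) → RookPath h w (h * w)
    snake h = record
      { cell     = cell
      ; bounded  = λ {k} k<hw → row< k<hw , orient< (row (position k)) (offset< k)
      ; distinct = λ _ _ → cell-injective _ _
      ; inLine   = λ {k} _ → cell-inLine k
      }
      where
      row< : ∀ {k} → k < h * w → row (position k) < h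
      row< {k} k<hw = *-cancelʳ-< w _ h (≤-<-trans (≤-trans (m≤m+n _ _) (≤-reflexive (index k))) k<hw)

snake₂-row : ∀ j → Snake.position 2 (j * 2) ≡ (j , 0)
snake₂-row zero = refl
snake₂-row (suc j) rewrite snake₂-row j = refl

-- The subset {a, b} of Fin p, its elements given by their values (cells of a
-- rook path are pairs of natural numbers).
pairSet : (p : ℕ) → ℕ → ℕ → Subset p
pairSet p a b = tabulate λ i → isYes (toℕ i ≟ a ⊎-dec toℕ i ≟ b)

∈-pairSet : ∀ {p a b} (i : Fin p) → i ∈ pairSet p a b ⇔ (toℕ i ≡ a ⊎ toℕ i ≡ b)
∈-pairSet {a = a} {b} i = mk⇔
  (λ i∈ → toWitness {a? = decide} (Equivalence.from T-≡ (trans (sym (lookup∘tabulate _ i)) ([]=⇒lookup i∈))))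
  (λ h → lookup⇒[]= i _ (trans (lookup∘tabulate _ i) (Equivalence.to T-≡ (fromWitness {a? = decide} h))))
  where
  decide : Dec (toℕ i ≡ a ⊎ toℕ i ≡ b)
  decide = toℕ i ≟ a ⊎-dec toℕ i ≟ b

endpoint : ∀ {u k} → k ≡ u ∸ 1 ⊎ k ≡ u → u ≡ k ⊎ u ≡ suc k
endpoint {zero} (inj₁ refl) = inj₁ refl
endpoint {suc u} (inj₁ refl) = inj₂ refl
endpoint (inj₂ refl) = inj₁ refl

endpoints-adjacent : ∀ {u v k : ℕ} → u ≡ k ⊎ u ≡ suc k → v ≡ k ⊎ v ≡ suc k → ¬ u ≡ v → suc u ≡ v ⊎ suc v ≡ u
endpoints-adjacent (inj₁ refl) (inj₁ refl) u≢v = ⊥-elim (u≢v refl)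
endpoints-adjacent (inj₁ refl) (inj₂ refl) _ = inj₁ refl
endpoints-adjacent (inj₂ refl) (inj₁ refl) _ = inj₂ refl
endpoints-adjacent (inj₂ refl) (inj₂ refl) u≢v = ⊥-elim (u≢v refl)

box-corners : ∀ {x y a b a' b' : ℕ} → a ≡ a' ⊎ b ≡ b' → x ≡ a ⊎ x ≡ a' → y ≡ b ⊎ y ≡ b' →
              (x , y) ≡ (a , b) ⊎ (x , y) ≡ (a' , b')
box-corners _ (inj₁ refl) (inj₁ refl) = inj₁ refl
box-corners _ (inj₂ refl) (inj₂ refl) = inj₂ refl
box-corners (inj₁ refl) (inj₁ refl) (inj₂ refl) = inj₂ refl
box-corners (inj₂ refl) (inj₁ refl) (inj₂ refl) = inj₁ refl
box-corners (inj₁ refl) (inj₂ refl) (inj₁ refl) = inj₁ refl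
box-corners (inj₂ refl) (inj₂ refl) (inj₁ refl) = inj₂ refl

-- The CIR of the path on m+2 vertices given by a rook path of length m+1: edge k
-- is the cell k, and a vertex gets the rows and the columns of its edges.
module RookCIR {p q m : ℕ} (P : RookPath p q (suc m)) where
  open RookPath P

  -- Vertex v meets the edges v - 1 and v, clamped into 0 … m.
  below above : ℕ → ℕ
  below v = v ∸ 1
  above v = v ⊓ m

  Incident : ℕ → ℕ → Set
  Incident v k = k ≡ below v ⊎ k ≡ above v

  rows : Fin (2 + m) → Subset p
  rows v = pairSet p (row (cell (below (toℕ v)))) (row (cell (above (toℕ v))))

  cols : Fin (2 + m) → Subset q
  cols v = pairSet q (col (cell (below (toℕ v)))) (col (cell (above (toℕ v))))

  above-cases : ∀ {v} → v ≤ suc m → (v ≤ m × above v ≡ v) ⊎ above v ≡ below v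
  above-cases {v} v≤m+1 with v ≤? m
  ... | yes v≤m = inj₁ (v≤m , m≤n⇒m⊓n≡m v≤m)
  ... | no v≰m rewrite ≤-antisym v≤m+1 (≰⇒> v≰m) = inj₂ (m≥n⇒m⊓n≡n (n≤1+n m))

  vertex≤ : (v : Fin (2 + m)) → toℕ v ≤ suc m
  vertex≤ v = s≤s⁻¹ (toℕ<n v)

  incident⇒endpoint : ∀ {v k} → v ≤ suc m → Incident v k → v ≡ k ⊎ v ≡ suc k
  incident⇒endpoint _ (inj₁ k≡) = endpoint (inj₁ k≡)
  incident⇒endpoint v≤ (inj₂ k≡) with above-cases v≤
  ... | inj₁ (_ , eq) = endpoint (inj₂ (trans k≡ eq))
  ... | inj₂ eq = endpoint (inj₁ (trans k≡ eq))

  incident< : ∀ {v k} → v ≤ suc m → Incident v k → k < suc m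
  incident< {suc v} (s≤s v≤m) (inj₁ refl) = s≤s v≤m
  incident< {zero} _ (inj₁ refl) = s≤s z≤n
  incident< {v} _ (inj₂ refl) = s≤s (m⊓n≤n v m)

  corner : ∀ {v} → v ≤ suc m → InLine (cell (below v)) (cell (above v))
  corner {v} v≤ with above-cases v≤
  ... | inj₂ eq rewrite eq = inj₁ refl
  corner {zero} v≤ | inj₁ (_ , eq) rewrite eq = inj₁ refl
  corner {suc v} v≤ | inj₁ (v+1≤m , eq) rewrite eq = inLine (s≤s v+1≤m)

  box-cell : ∀ v (x : Fin p) (y : Fin q) → x ∈ rows v → y ∈ cols v →
             Σ ℕ λ k → Incident (toℕ v) k × (toℕ x , toℕ y) ≡ cell k
  box-cell v x y x∈ y∈
    with box-corners (corner (vertex≤ v)) (Equivalence.to (∈-pairSet x) x∈) (Equivalence.to (∈-pairSet y) y∈)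
  ... | inj₁ eq = below (toℕ v) , inj₁ refl , eq
  ... | inj₂ eq = above (toℕ v) , inj₂ refl , eq

  -- If u and v share a row x and a column y, the cell (x, y) is the cell of an
  -- edge at u and of an edge at v; as cells are distinct, u and v are its endpoints.
  shared⇒adjacent : ∀ u v → ¬ u ≡ v → Nonempty (rows u ∩ rows v) × Nonempty (cols u ∩ cols v) → Path (2 + m) u v
  shared⇒adjacent u v u≢v ((x , x∈) , (y , y∈))
    with x∈p∩q⁻ (rows u) (rows v) x∈ | x∈p∩q⁻ (cols u) (cols v) y∈
  ... | x∈u , x∈v | y∈u , y∈v
    with box-cell u x y x∈u y∈u | box-cell v x y x∈v y∈v
  ... | k , k-at-u , eq-u | l , l-at-v , eq-v
    with distinct (incident< (vertex≤ u) k-at-u) (incident< (vertex≤ v) l-at-v) (trans (sym eq-u) eq-v)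
  ... | refl = endpoints-adjacent (incident⇒endpoint (vertex≤ u) k-at-u) (incident⇒endpoint (vertex≤ v) l-at-v)
                                  (u≢v ∘ toℕ-injective)

  common-edge : ∀ u v {k} → k < suc m → Incident (toℕ u) k → Incident (toℕ v) k →
                Nonempty (rows u ∩ rows v) × Nonempty (cols u ∩ cols v)
  common-edge u v {k} k< k-at-u k-at-v =
      (x , x∈p∩q⁺ (member row (toℕ-fromℕ< r<) k-at-u , member row (toℕ-fromℕ< r<) k-at-v))
    , (y , x∈p∩q⁺ (member col (toℕ-fromℕ< c<) k-at-u , member col (toℕ-fromℕ< c<) k-at-v))
    where
    r< : row (cell k) < p
    r< = proj₁ (bounded k<)
    c< : col (cell k) < q
    c< = proj₂ (bounded k<)
    x : Fin p
    x = fromℕ< r<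
    y : Fin q
    y = fromℕ< c<
    member : ∀ {s} (f : ℕ × ℕ → ℕ) {w : Fin (2 + m)} {i : Fin s} → toℕ i ≡ f (cell k) → Incident (toℕ w) k →
             i ∈ pairSet s (f (cell (below (toℕ w)))) (f (cell (above (toℕ w))))
    member f {i = i} eq (inj₁ refl) = Equivalence.from (∈-pairSet i) (inj₁ eq)
    member f {i = i} eq (inj₂ refl) = Equivalence.from (∈-pairSet i) (inj₂ eq)

  adjacent-edge : ∀ (u v : Fin (2 + m)) → suc (toℕ u) ≡ toℕ v → toℕ u < suc m × Incident (toℕ u) (toℕ u) × Incident (toℕ v) (toℕ u)
  adjacent-edge u v u+1≡v = u<m+1 , inj₂ (sym (m≤n⇒m⊓n≡m (s≤s⁻¹ u<m+1))) , inj₁ (cong pred u+1≡v)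
    where
    u<m+1 : toℕ u < suc m
    u<m+1 = ≤-trans (≤-reflexive u+1≡v) (vertex≤ v)

  adjacent⇒shared : ∀ u v → Path (2 + m) u v → Nonempty (rows u ∩ rows v) × Nonempty (cols u ∩ cols v)
  adjacent⇒shared u v (inj₁ u+1≡v) = let (k< , at-u , at-v) = adjacent-edge u v u+1≡v in common-edge u v k< at-u at-v
  adjacent⇒shared u v (inj₂ v+1≡u) = let (k< , at-v , at-u) = adjacent-edge v u v+1≡u in common-edge u v k< at-u at-v

  cir : CIR (Path (2 + m))
  cir = record
    { α = p ; β = q
    ; α-pos = ≤-trans (s≤s z≤n) (proj₁ (bounded (s≤s z≤n)))
    ; β-pos = ≤-trans (s≤s z≤n) (proj₂ (bounded (s≤s z≤n)))
    ; A = rows ; B = cols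
    ; rep = λ u v u≢v → mk⇔ (adjacent⇒shared u v) (shared⇒adjacent u v u≢v)
    }

rookCIR : ∀ {p q m} → RookPath p q (suc m) → CIR (Path (2 + m))
rookCIR P = RookCIR.cir P

v₁ v₂ : ∀ {k} → Fin (3 + k)
v₁ = suc zero
v₂ = suc (suc zero)

-- Row by row through a grid with rows of length ≥ 3: the first three cells lie
-- in row 0, so vertices 1 and 2 both get the row set {0}.
straight : ∀ p q' {m} → m ≤ p * (3 + q') → RookPath p (3 + q') m
straight p q' m≤ = truncate m≤ (Snake.snake (3 + q') (s≤s z≤n) p)

straight-twins : ∀ p q' {m} (m≤ : 3 + m ≤ p * (3 + q')) → Twins (rookCIR (straight p q' m≤)) v₁ v₂
straight-twins p q' m≤ = inj₁ refl

-- Column by column through the top two rows, (0,0), (1,0), (1,1), (0,1), …,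
-- then the remaining rows by a mirrored snake starting in the last column.
-- It turns at once, so vertices 1 and 2 share neither rows nor columns.
hook : ∀ p' q'' {m} → m ≤ (2 + p') * (2 + q'') → RookPath (2 + p') (2 + q'') m
hook p' q'' {m} m≤ = truncate (subst (m ≤_) length m≤) (stack top rest junction)
  where
  q = 2 + q''
  top : RookPath 2 q (q * 2)
  top = transpose (Snake.snake 2 (s≤s z≤n) q)
  rest : RookPath p' q (p' * q)
  rest = mirror (Snake.snake q (s≤s z≤n) p')
  junction : col (RookPath.cell top (pred (q * 2))) ≡ col (RookPath.cell rest 0)
  junction = cong (row ∘ Snake.next 2) (snake₂-row (suc q''))
  length : (2 + p') * q ≡ q * 2 + p' * q
  length = trans (*-distribʳ-+ q 2 p') (cong (_+ p' * q) (*-comm 2 q))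

hook-not-twins : ∀ p' q'' {m} (m≤ : 3 + m ≤ (2 + p') * (2 + q'')) → ¬ Twins (rookCIR (hook p' q'' m≤)) v₁ v₂
hook-not-twins p' q'' m≤ (inj₁ ())
hook-not-twins p' q'' m≤ (inj₂ ())

-- Rebalancing a grid (a, b) with a + b kept and room for m ≥ 3 cells, m ≠ 4,
-- so that one side is at least 3 (only the 2 × 2 grid needs to change, to 1 × 3).
widen : ∀ {m} a b → 1 ≤ a → 1 ≤ b → 3 ≤ m → ¬ m ≡ 4 → m ≤ a * b →
        Σ ℕ λ p → Σ ℕ λ q' → p + (3 + q') ≡ a + b × m ≤ p * (3 + q')
widen a (suc (suc (suc b'))) _ _ _ _ m≤ab = a , b' , refl , m≤ab
widen {m} (suc (suc (suc a'))) b _ _ _ _ m≤ab = b , a' , +-comm b (3 + a') , subst (m ≤_) (*-comm (3 + a') b) m≤ab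
widen {3} 2 2 _ _ _ _ _ = 1 , 0 , refl , ≤-refl
widen {4} 2 2 _ _ _ m≢4 _ = ⊥-elim (m≢4 refl)
widen {suc (suc (suc (suc (suc _))))} 2 2 _ _ _ _ (s≤s (s≤s (s≤s (s≤s ()))))
widen {1} 2 2 _ _ (s≤s ()) _ _
widen {2} 2 2 _ _ (s≤s (s≤s ())) _ _
widen 1 1 _ _ (s≤s (s≤s (s≤s _))) _ (s≤s ())
widen 1 2 _ _ (s≤s (s≤s (s≤s _))) _ (s≤s (s≤s ()))
widen 2 1 _ _ (s≤s (s≤s (s≤s _))) _ (s≤s (s≤s ()))

thicken : ∀ {m} b → 3 ≤ m → m ≤ 1 * b → Σ ℕ λ q'' → 2 + (2 + q'') ≡ 1 + b × m ≤ 2 * (2 + q'')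
thicken {m} (suc (suc (suc b'))) _ m≤b = b' , refl , ≤-trans (subst (m ≤_) (*-identityˡ (3 + b')) m≤b) room
  where
  room : 3 + b' ≤ 2 * (2 + b')
  room = s≤s (s≤s (≤-trans (s≤s (m≤m+n b' _)) (≤-reflexive (sym (+-suc b' _)))))
thicken 0 (s≤s _) ()
thicken 1 (s≤s (s≤s (s≤s _))) (s≤s ())
thicken 2 (s≤s (s≤s (s≤s _))) (s≤s (s≤s ()))

squarish : ∀ {m} a b → 1 ≤ a → 1 ≤ b → 3 ≤ m → m ≤ a * b →
           Σ ℕ λ p' → Σ ℕ λ q'' → (2 + p') + (2 + q'') ≡ a + b × m ≤ (2 + p') * (2 + q'')
squarish (suc (suc a')) (suc (suc b')) _ _ _ m≤ab = a' , b' , refl , m≤ab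
squarish 1 b _ _ 3≤m m≤b = let (q'' , sum , m≤) = thicken b 3≤m m≤b in 0 , q'' , sum , m≤
squarish {m} (suc (suc a')) 1 _ _ 3≤m m≤a = let (q'' , sum , m≤) = thicken (2 + a') 3≤m (subst (m ≤_) (*-comm (2 + a') 1) m≤a) in
  q'' , 0 , trans (+-comm (2 + q'') 2) (trans sum (+-comm 1 (2 + a'))) , subst (m ≤_) (*-comm 2 (2 + q'')) m≤

corollary5 : (n : ℕ) → 4 ≤ n → ¬ (n ≡ 5) → ¬ UniquelyCointersectable (Path n)
corollary5 (suc (suc (suc zero))) (s≤s (s≤s (s≤s ())))
corollary5 (suc (suc (suc (suc m)))) _ n≢5 unique =
  optimal-exists (rookCIR (straight 1 m (≤-reflexive (sym (*-identityˡ _))))) no-optimum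
  where
  no-optimum : ¬ Σ (CIR (Path (4 + m))) Optimal
  no-optimum (R , opt) =
    let (p , q' , sum₁ , fits₁)   = widen (α R) (β R) (α-pos R) (β-pos R) (s≤s (s≤s (s≤s z≤n))) (n≢5 ∘ cong suc) (edges≤cells R)
        (p' , q'' , sum₂ , fits₂) = squarish (α R) (β R) (α-pos R) (β-pos R) (s≤s (s≤s (s≤s z≤n))) (edges≤cells R)
        S₁ = rookCIR (straight p q' fits₁)
        S₂ = rookCIR (hook p' q'' fits₂)
        equivalent = unique S₁ S₂ (optimal-of-size R S₁ opt sum₁) (optimal-of-size R S₂ opt sum₂)
    in hook-not-twins p' q'' fits₂ (twins-invariant {R = S₁} {S₂} v₁ v₂ equivalent (straight-twins p q' fits₁))
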